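{- There exists a hypergraphic preference system $I=(H=(V,E),\succ)$ with $H$ an interval hypergraph such that the fractional stable matching polytope $Q(I)$ is not integral; consequently $P(I)\neq Q(I)$.
   Context: A hypergraphic preference system $(H=(V,E),\succ)$ consists of a hypergraph $H$ and, for each $i\in V$, a strict order $\succ_i$ on $\delta(i)=\{e\in E:i\in e\}$. Each singleton $\{i\}$ is assumed to be in $E$ and to be the least preferred element of $\delta(i)$. A stable matching is $x\in\{0,1\}^E$ such that for every $e\in E$ there is $i\in e$ with $\sum_{e'\in\delta(i),\,e'\succeq_i e}x_{e'}=1$, where $\succeq_i$ means $\succ_i$ or equal. A hypergraph is an interval hypergraph if $V=[n]$ and every hyperedge has the form $\{i,i+1,\dots,j\}$ with $i\le j$. $P(I)$ is the convex hull of all stable matchings. $Q(I)=\{x\in\mathbb{R}^E: x(\delta(i))\le1\ \forall i\in V;\ x(e^{\succeq})\ge1\ \forall e\in E;\ 0\le x_e\le1\ \forall e\in E\}$. Here $x(F)=\sum_{e\in F}x_e$ and $e^{\succeq}=\{e'\in E:\exists i\in e,\ e'\succ_i e\}\cup\{e\}$. A polytope is integral if all its extreme points are integer vectors.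
   Formalization: The polytopes Q(I) and P(I), their extreme points and the comparison of P(I) with Q(I) are taken in ℚ^E, with rational convex coefficients, rather than in ℝ^E. -}

module Defs where

open import Data.Nat as ℕ using (ℕ)
open import Data.Fin using (Fin; _≤_; _≤?_)
open import Data.Bool using (Bool; true; false; T; _∧_; _∨_; if_then_else_)
open import Data.List using (List; []; _∷_; foldr; map; allFin)
open import Data.Bool.ListAction using (any)
open import Data.List.Relation.Unary.All using (All)
open import Data.Integer using (ℤ)
open import Data.Rational as ℚ using (ℚ; 0ℚ; 1ℚ)
open import Data.Product using (Σ; ∃; _×_; _,_; proj₁; proj₂)
open import Data.Sum using (_⊎_)
open import Relation.Binary.PropositionalEquality using (_≡_; _≢_)
open import Relation.Nullary using (¬_)
open import Relation.Nullary.Decidable using (⌊_⌋)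
open import Function.Bundles using (_⇔_)

-- V = Fin n (i.e. [n], 0-indexed); E is indexed by Fin m, hyperedge e
-- being the interval {left e, ..., right e}.  Distinct indices are
-- distinct hyperedges (E is a set).  pref i e e' = true means e ≻_i e'.

record IntervalHPS : Set where
  field
    n m   : ℕ
    left  : Fin m → Fin n
    right : Fin m → Fin n
    left≤right : ∀ e → left e ≤ right e
    edges-distinct : ∀ e e' → left e ≡ left e' → right e ≡ right e' → e ≡ e'
    singletons : ∀ i → ∃ λ e → left e ≡ i × right e ≡ i
    pref : Fin n → Fin m → Fin m → Bool

  _∈ₕ_ : Fin n → Fin m → Set
  i ∈ₕ e = left e ≤ i × i ≤ right e

  inₕ : Fin n → Fin m → Bool
  inₕ i e = ⌊ left e ≤? i ⌋ ∧ ⌊ i ≤? right e ⌋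

  _≻⟨_⟩_ : Fin m → Fin n → Fin m → Set
  e ≻⟨ i ⟩ e' = T (pref i e e')

  field
    ≻-irrefl : ∀ i e → i ∈ₕ e → ¬ (e ≻⟨ i ⟩ e)
    ≻-trans  : ∀ i e₁ e₂ e₃ → i ∈ₕ e₁ → i ∈ₕ e₂ → i ∈ₕ e₃ →
               e₁ ≻⟨ i ⟩ e₂ → e₂ ≻⟨ i ⟩ e₃ → e₁ ≻⟨ i ⟩ e₃
    ≻-total  : ∀ i e e' → i ∈ₕ e → i ∈ₕ e' → e ≢ e' →
               (e ≻⟨ i ⟩ e') ⊎ (e' ≻⟨ i ⟩ e)
    singleton-least : ∀ i e s → i ∈ₕ e → left s ≡ i → right s ≡ i → e ≢ s →
                      e ≻⟨ i ⟩ s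

open IntervalHPS public

sumOver : ∀ {m} → (Fin m → Bool) → (Fin m → ℚ) → ℚ
sumOver {m} F x = foldr ℚ._+_ 0ℚ (map (λ e → if F e then x e else 0ℚ) (allFin m))

module _ (I : IntervalHPS) where

  δ : Fin (n I) → Fin (m I) → Bool
  δ i e = inₕ I i e

  -- e' ∈ e^{⪰} : e' = e, or e' ≻_i e for some i ∈ e (and then i ∈ e')
  upset : Fin (m I) → Fin (m I) → Bool
  upset e e' = ⌊ e' Data.Fin.≟ e ⌋ ∨
               any (λ i → inₕ I i e ∧ inₕ I i e' ∧ pref I i e' e) (allFin (n I))

  weakly-better : Fin (n I) → Fin (m I) → Fin (m I) → Bool
  weakly-better i e e' = inₕ I i e' ∧ (⌊ e' Data.Fin.≟ e ⌋ ∨ pref I i e' e)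

  toℚ : Bool → ℚ
  toℚ true  = 1ℚ
  toℚ false = 0ℚ

  IsMatching : (Fin (m I) → Bool) → Set
  IsMatching x = ∀ i → sumOver (δ i) (λ e → toℚ (x e)) ℚ.≤ 1ℚ

  IsStable : (Fin (m I) → Bool) → Set
  IsStable x = ∀ e → ∃ λ i → _∈ₕ_ I i e ×
               sumOver (weakly-better i e) (λ e' → toℚ (x e')) ≡ 1ℚ

  IsStableMatching : (Fin (m I) → Bool) → Set
  IsStableMatching x = IsMatching x × IsStable x

  InQ : (Fin (m I) → ℚ) → Set
  InQ x = (∀ i → sumOver (δ i) x ℚ.≤ 1ℚ) ×
          (∀ e → 1ℚ ℚ.≤ sumOver (upset e) x) ×
          (∀ e → 0ℚ ℚ.≤ x e × x e ℚ.≤ 1ℚ)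

  InP : (Fin (m I) → ℚ) → Set
  InP x = Σ (List (ℚ × (Fin (m I) → Bool))) λ cs →
          All (λ c → 0ℚ ℚ.≤ proj₁ c × IsStableMatching (proj₂ c)) cs ×
          foldr ℚ._+_ 0ℚ (map proj₁ cs) ≡ 1ℚ ×
          (∀ e → x e ≡ foldr ℚ._+_ 0ℚ (map (λ c → proj₁ c ℚ.* toℚ (proj₂ c e)) cs))

  IsExtremeQ : (Fin (m I) → ℚ) → Set
  IsExtremeQ x = InQ x × (∀ y z (t : ℚ) → InQ y → InQ z → 0ℚ ℚ.< t → t ℚ.< 1ℚ →
                  (∀ e → x e ≡ t ℚ.* y e ℚ.+ (1ℚ ℚ.- t) ℚ.* z e) →
                  ∀ e → y e ≡ z e)

  IsIntegralVec : (Fin (m I) → ℚ) → Set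
  IsIntegralVec x = ∀ e → ∃ λ (k : ℤ) → x e ≡ k ℚ./ 1

  QIntegral : Set
  QIntegral = ∀ x → IsExtremeQ x → IsIntegralVec x

  P≡Q : Set
  P≡Q = ∀ x → InP x ⇔ InQ x

-- Take V = {0,1,2,3} with hyperedges e₀₁ = {0,1}, e₀₂ = {0,1,2}, e₀₃ = {0,1,2,3}, e₂₃ = {2,3}
-- besides the singletons, and preferences
--   0 : e₀₁ ≻ e₀₂ ≻ e₀₃,   1 : e₀₂ ≻ e₀₃ ≻ e₀₁,   2 : e₂₃ ≻ e₀₂ ≻ e₀₃,   3 : e₀₃ ≻ e₂₃.
-- Let x be ½ on e₀₁, e₀₃, e₂₃ and 0 elsewhere. It lies in Q(I), and it is a vertex: if x is a
-- proper convex combination of y, z ∈ Q(I), then y satisfies with equality every constraint that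
-- x does, so y vanishes off {e₀₁, e₀₃, e₂₃} and y(δ(0)) = y(δ(3)) = y(e₀₂^⪰) = 1, that is
-- y₀₁ + y₀₃ = y₀₃ + y₂₃ = y₂₃ + y₀₁ = 1, whence y = x.
-- But no stable matching uses e₀₃: it covers every vertex, so it would be the only matched edge,
-- and then e₀₂ blocks, as each of its vertices prefers e₀₂ to e₀₃. So x ∉ P(I).
module Submission where

open import Defs
open import Level using (0ℓ)
open import Data.Nat as ℕ using (ℕ; _<ᵇ_)
import Data.Nat.Properties as ℕP
open import Data.Nat.GCD using (gcd-zeroʳ)
open import Data.Fin as Fin using (Fin; zero; suc; _≤?_; _≟_)
open import Data.Fin.Properties using (all?)
open import Data.Bool using (Bool; true; false; T; if_then_else_)
open import Data.Bool.Properties using (T-≡; T-∧; ¬-not)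
open import Data.Empty using (⊥-elim)
open import Data.List as List using (List; foldr; map; allFin)
open import Data.List.Membership.Propositional using (_∈_)
open import Data.List.Membership.Propositional.Properties using (∈-allFin)
open import Data.List.Relation.Unary.Any using (here; there)
open import Data.List.Relation.Unary.All as All using (All)
open import Data.Integer as ℤ using (ℤ)
open import Data.Rational as ℚ using (ℚ; 0ℚ; 1ℚ; ½; _+_; _*_; _-_)
import Data.Rational.Properties as ℚP
open import Data.Product using (Σ; ∃; _×_; _,_; proj₁; proj₂)
open import Data.Sum using (_⊎_; inj₁; inj₂)
open import Function.Bundles using (Equivalence)
open import Relation.Nullary using (¬_; Dec; yes; no)
open import Relation.Nullary.Decidable
  using (toWitness; fromWitness; toWitnessFalse; from-yes; dec⇒maybe; _→-dec_; _×-dec_; _⊎-dec_; ¬?; T?)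
open import Relation.Binary.PropositionalEquality using (_≡_; _≢_; refl; sym; trans; cong; cong₂; subst)
open import Tactic.RingSolver.Core.AlmostCommutativeRing using (AlmostCommutativeRing; fromCommutativeRing)
import Tactic.RingSolver as RingSolver

ℚ-ring : AlmostCommutativeRing 0ℓ 0ℓ
ℚ-ring = fromCommutativeRing ℚP.+-*-commutativeRing (λ q → dec⇒maybe (0ℚ ℚ.≟ q))

sumList : ∀ {A : Set} → (A → ℚ) → List A → ℚ
sumList f l = foldr _+_ 0ℚ (map f l)

masked : ∀ {m} → (Fin m → Bool) → (Fin m → ℚ) → Fin m → ℚ
masked F x e = if F e then x e else 0ℚ

module _ {A : Set} where

  sumList-cong : ∀ {f g : A → ℚ} → (∀ a → f a ≡ g a) → ∀ l → sumList f l ≡ sumList g l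
  sumList-cong f≡g List.[]      = refl
  sumList-cong f≡g (a List.∷ l) = cong₂ _+_ (f≡g a) (sumList-cong f≡g l)

  sumList-linear : ∀ s u (f g : A → ℚ) l →
                   sumList (λ a → s * f a + u * g a) l ≡ s * sumList f l + u * sumList g l
  sumList-linear s u f g List.[]      = RingSolver.solve (s List.∷ u List.∷ List.[]) ℚ-ring
  sumList-linear s u f g (a List.∷ l) =
    trans (cong (s * f a + u * g a +_) (sumList-linear s u f g l))
          (regroup s u (f a) (g a) (sumList f l) (sumList g l))
    where
    regroup : ∀ s u p q P Q → s * p + u * q + (s * P + u * Q) ≡ s * (p + P) + u * (q + Q)
    regroup = RingSolver.solve-∀ ℚ-ring

  sumList-zero : ∀ {f : A → ℚ} {l} → All (λ a → f a ≡ 0ℚ) l → sumList f l ≡ 0ℚ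
  sumList-zero All.[]          = refl
  sumList-zero (fa≡0 All.∷ f≡0) = trans (cong₂ _+_ fa≡0 (sumList-zero f≡0)) (ℚP.+-identityˡ 0ℚ)

  module _ {f : A → ℚ} (f≥0 : ∀ a → 0ℚ ℚ.≤ f a) where

    ≤-+-nonNeg : ∀ a q → q ℚ.≤ f a + q
    ≤-+-nonNeg a q = subst (ℚ._≤ f a + q) (ℚP.+-identityˡ q) (ℚP.+-monoˡ-≤ q (f≥0 a))

    sumList-nonNeg : ∀ l → 0ℚ ℚ.≤ sumList f l
    sumList-nonNeg List.[]      = ℚP.≤-refl
    sumList-nonNeg (a List.∷ l) = ℚP.≤-trans (sumList-nonNeg l) (≤-+-nonNeg a (sumList f l))

    ∈⇒≤-sumList : ∀ {a l} → a ∈ l → f a ℚ.≤ sumList f l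
    ∈⇒≤-sumList {a} {_ List.∷ l} (here refl) =
      subst (ℚ._≤ f a + sumList f l) (ℚP.+-identityʳ (f a)) (ℚP.+-monoʳ-≤ (f a) (sumList-nonNeg l))
    ∈⇒≤-sumList {l = b List.∷ l} (there a∈l) =
      ℚP.≤-trans (∈⇒≤-sumList a∈l) (≤-+-nonNeg b (sumList f l))

    ∈∧∈⇒≤-sumList : ∀ {a b l} → a ≢ b → a ∈ l → b ∈ l → f a + f b ℚ.≤ sumList f l
    ∈∧∈⇒≤-sumList a≢b (here refl) (here refl) = ⊥-elim (a≢b refl)
    ∈∧∈⇒≤-sumList {a} a≢b (here refl) (there b∈l) = ℚP.+-monoʳ-≤ (f a) (∈⇒≤-sumList b∈l)
    ∈∧∈⇒≤-sumList {a} {b} {_ List.∷ l} a≢b (there a∈l) (here refl) =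
      subst (ℚ._≤ f b + sumList f l) (ℚP.+-comm (f b) (f a)) (ℚP.+-monoʳ-≤ (f b) (∈⇒≤-sumList a∈l))
    ∈∧∈⇒≤-sumList {a} {b} {c List.∷ l} a≢b (there a∈l) (there b∈l) =
      ℚP.≤-trans (∈∧∈⇒≤-sumList a≢b a∈l b∈l) (≤-+-nonNeg c (sumList f l))

sumOver-cong : ∀ {m} F {x y : Fin m → ℚ} → (∀ e → x e ≡ y e) → sumOver F x ≡ sumOver F y
sumOver-cong {m} F x≡y = sumList-cong (λ e → cong (λ v → if F e then v else 0ℚ) (x≡y e)) (allFin m)

sumOver-linear : ∀ {m} F s u (y z : Fin m → ℚ) →
                 sumOver F (λ e → s * y e + u * z e) ≡ s * sumOver F y + u * sumOver F z
sumOver-linear {m} F s u y z =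
  trans (sumList-cong masked-linear (allFin m))
        (sumList-linear s u (masked F y) (masked F z) (allFin m))
  where
  masked-linear : ∀ e → masked F (λ e → s * y e + u * z e) e ≡ s * masked F y e + u * masked F z e
  masked-linear e with F e
  ... | true  = refl
  ... | false = RingSolver.solve (s List.∷ u List.∷ List.[]) ℚ-ring

module _ {s u : ℚ} (s>0 : 0ℚ ℚ.< s) (u>0 : 0ℚ ℚ.< u) (s+u≡1 : s + u ≡ 1ℚ) where

  private instance
    s-positive : ℚ.Positive s
    s-positive = ℚ.positive s>0
    u-nonNegative : ℚ.NonNegative u
    u-nonNegative = ℚ.nonNegative (ℚP.<⇒≤ u>0)

  combination-diagonal : ∀ β → s * β + u * β ≡ β
  combination-diagonal β =
    trans (sym (ℚP.*-distribʳ-+ β s u)) (trans (cong (_* β) s+u≡1) (ℚP.*-identityˡ β))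

  combination-at-upper-bound : ∀ {a b β} → a ℚ.≤ β → b ℚ.≤ β → s * a + u * b ≡ β → a ≡ β
  combination-at-upper-bound {a} {b} {β} a≤β b≤β sa+ub≡β =
    ℚP.≤-antisym a≤β (ℚP.≮⇒≥ λ a<β → ℚP.<-irrefl refl (β<β a<β))
    where
    open ℚP.≤-Reasoning
    β<β : a ℚ.< β → β ℚ.< β
    β<β a<β = begin-strict
      β             ≡⟨ sym sa+ub≡β ⟩
      s * a + u * b <⟨ ℚP.+-mono-<-≤ (ℚP.*-monoʳ-<-pos s a<β) ℚP.≤-refl ⟩
      s * β + u * b ≤⟨ ℚP.+-monoʳ-≤ (s * β) (ℚP.*-monoˡ-≤-nonNeg u b≤β) ⟩
      s * β + u * β ≡⟨ combination-diagonal β ⟩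
      β             ∎

  combination-at-lower-bound : ∀ {a b β} → β ℚ.≤ a → β ℚ.≤ b → s * a + u * b ≡ β → a ≡ β
  combination-at-lower-bound {a} {b} {β} β≤a β≤b sa+ub≡β =
    ℚP.≤-antisym (ℚP.≮⇒≥ λ β<a → ℚP.<-irrefl refl (β<β β<a)) β≤a
    where
    open ℚP.≤-Reasoning
    β<β : β ℚ.< a → β ℚ.< β
    β<β β<a = begin-strict
      β             ≡⟨ sym (combination-diagonal β) ⟩
      s * β + u * β ≤⟨ ℚP.+-monoʳ-≤ (s * β) (ℚP.*-monoˡ-≤-nonNeg u β≤b) ⟩
      s * β + u * b <⟨ ℚP.+-mono-<-≤ (ℚP.*-monoʳ-<-pos s β<a) ℚP.≤-refl ⟩
      s * a + u * b ≡⟨ sa+ub≡β ⟩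
      β             ∎

module _ (I : IntervalHPS) where

  ∈ₕ⇒inₕ : ∀ {i e} → _∈ₕ_ I i e → T (inₕ I i e)
  ∈ₕ⇒inₕ {i} {e} (l≤i , i≤r) =
    Equivalence.from T-∧
      (fromWitness {a? = left I e ≤? i} l≤i , fromWitness {a? = i ≤? right I e} i≤r)

  toℚ-nonNeg : ∀ b → 0ℚ ℚ.≤ toℚ I b
  toℚ-nonNeg true  = ℚP.nonNegative⁻¹ 1ℚ
  toℚ-nonNeg false = ℚP.≤-refl

  masked-toℚ-nonNeg : ∀ F (x : Fin (m I) → Bool) e → 0ℚ ℚ.≤ masked F (λ e → toℚ I (x e)) e
  masked-toℚ-nonNeg F x e with F e
  ... | true  = toℚ-nonNeg (x e)
  ... | false = ℚP.≤-refl

  matching-one-edge-per-vertex : ∀ {x i e e'} → IsMatching I x → _∈ₕ_ I i e → _∈ₕ_ I i e' →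
                                 x e ≡ true → x e' ≡ true → e ≡ e'
  matching-one-edge-per-vertex {x} {i} {e} {e'} matching i∈e i∈e' xe xe' with e ≟ e'
  ... | yes e≡e' = e≡e'
  ... | no  e≢e' = ⊥-elim (toWitnessFalse {a? = 1ℚ + 1ℚ ℚ.≤? 1ℚ} _
          (ℚP.≤-trans two≤degree (matching i)))
    where
    selected : ∀ {e} → _∈ₕ_ I i e → x e ≡ true → masked (δ I i) (λ e → toℚ I (x e)) e ≡ 1ℚ
    selected i∈e xe rewrite Equivalence.to T-≡ (∈ₕ⇒inₕ i∈e) | xe = refl
    two≤degree : 1ℚ + 1ℚ ℚ.≤ sumOver (δ I i) (λ e → toℚ I (x e))
    two≤degree = subst (ℚ._≤ sumOver (δ I i) (λ e → toℚ I (x e)))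
      (cong₂ _+_ (selected i∈e xe) (selected i∈e' xe'))
      (∈∧∈⇒≤-sumList (masked-toℚ-nonNeg (δ I i) x) e≢e' (∈-allFin e) (∈-allFin e'))

  sumOver-unselected : ∀ F (x : Fin (m I) → Bool) → (∀ e → T (F e) → x e ≡ false) →
                       sumOver F (λ e → toℚ I (x e)) ≡ 0ℚ
  sumOver-unselected F x unselected = sumList-zero (All.universal masked-zero (allFin (m I)))
    where
    masked-zero : ∀ e → masked F (λ e → toℚ I (x e)) e ≡ 0ℚ
    masked-zero e with F e | unselected e
    ... | true  | xe≡false = cong (toℚ I) (xe≡false _)
    ... | false | _        = refl

  blocking : ∀ {x e} → (∀ i e' → _∈ₕ_ I i e → T (weakly-better I i e e') → x e' ≡ false) →
             ¬ (∃ λ i → _∈ₕ_ I i e × sumOver (weakly-better I i e) (λ e' → toℚ I (x e')) ≡ 1ℚ)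
  blocking {x} {e} unselected (i , i∈e , tight) =
    ℚP.1≢0 (trans (sym tight)
      (sumOver-unselected (weakly-better I i e) x λ e' → unselected i e' i∈e))

  never-selected⇒zero-in-P : ∀ {x e} → (∀ s → IsStableMatching I s → s e ≡ false) →
                             InP I x → x e ≡ 0ℚ
  never-selected⇒zero-in-P {x} {e} never (cs , stable , _ , x≡) =
    trans (x≡ e) (sumList-zero (weights-zero stable))
    where
    weight-zero : ∀ {c} → 0ℚ ℚ.≤ proj₁ c × IsStableMatching I (proj₂ c) →
                  proj₁ c * toℚ I (proj₂ c e) ≡ 0ℚ
    weight-zero {w , s} (_ , s-stable) =
      trans (cong (λ b → w * toℚ I b) (never s s-stable)) (ℚP.*-zeroʳ w)
    weights-zero : ∀ {cs} → All (λ c → 0ℚ ℚ.≤ proj₁ c × IsStableMatching I (proj₂ c)) cs →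
                   All (λ c → proj₁ c * toℚ I (proj₂ c e) ≡ 0ℚ) cs
    weights-zero = All.map λ {c} → weight-zero {c}

  module FaceOfQ {x y z : Fin (m I) → ℚ} {s u : ℚ}
                 (s>0 : 0ℚ ℚ.< s) (u>0 : 0ℚ ℚ.< u) (s+u≡1 : s + u ≡ 1ℚ)
                 (y∈Q : InQ I y) (z∈Q : InQ I z) (x≡ : ∀ e → x e ≡ s * y e + u * z e) where

    sumOver-combination : ∀ F → s * sumOver F y + u * sumOver F z ≡ sumOver F x
    sumOver-combination F = sym (trans (sumOver-cong F x≡) (sumOver-linear F s u y z))

    zero-inherited : ∀ e → x e ≡ 0ℚ → y e ≡ 0ℚ
    zero-inherited e xe≡0 = combination-at-lower-bound s>0 u>0 s+u≡1
      (proj₁ (proj₂ (proj₂ y∈Q) e)) (proj₁ (proj₂ (proj₂ z∈Q) e)) (trans (sym (x≡ e)) xe≡0)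

    degree-tight-inherited : ∀ i → sumOver (δ I i) x ≡ 1ℚ → sumOver (δ I i) y ≡ 1ℚ
    degree-tight-inherited i tight = combination-at-upper-bound s>0 u>0 s+u≡1
      (proj₁ y∈Q i) (proj₁ z∈Q i) (trans (sumOver-combination (δ I i)) tight)

    upset-tight-inherited : ∀ e → sumOver (upset I e) x ≡ 1ℚ → sumOver (upset I e) y ≡ 1ℚ
    upset-tight-inherited e tight = combination-at-lower-bound s>0 u>0 s+u≡1
      (proj₁ (proj₂ y∈Q) e) (proj₁ (proj₂ z∈Q) e) (trans (sumOver-combination (upset I e)) tight)

pairwise-sums-one⇒half : ∀ p q r → p + q ≡ 1ℚ → q + r ≡ 1ℚ → r + p ≡ 1ℚ → p ≡ ½
pairwise-sums-one⇒half p q r p+q≡1 q+r≡1 r+p≡1 = begin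
  p                                 ≡⟨ eliminate-q-r p q r ⟩
  ½ * ((p + q) + (r + p) - (q + r)) ≡⟨ cong₂ (λ a b → ½ * (a + b - (q + r))) p+q≡1 r+p≡1 ⟩
  ½ * (1ℚ + 1ℚ - (q + r))           ≡⟨ cong (λ c → ½ * (1ℚ + 1ℚ - c)) q+r≡1 ⟩
  ½                                 ∎
  where
  open Relation.Binary.PropositionalEquality.≡-Reasoning
  eliminate-q-r : ∀ p q r → p ≡ ½ * ((p + q) + (r + p) - (q + r))
  eliminate-q-r = RingSolver.solve-∀ ℚ-ring

pattern v₀ = zero
pattern v₁ = suc v₀
pattern v₂ = suc v₁
pattern v₃ = suc v₂

pattern s₀  = zero
pattern s₁  = suc s₀
pattern s₂  = suc s₁
pattern s₃  = suc s₂
pattern e₀₁ = suc s₃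
pattern e₀₂ = suc e₀₁
pattern e₀₃ = suc e₀₂
pattern e₂₃ = suc e₀₃

left-end right-end : Fin 8 → Fin 4
left-end s₀  = v₀
left-end s₁  = v₁
left-end s₂  = v₂
left-end s₃  = v₃
left-end e₀₁ = v₀
left-end e₀₂ = v₀
left-end e₀₃ = v₀
left-end e₂₃ = v₂
right-end s₀  = v₀
right-end s₁  = v₁
right-end s₂  = v₂
right-end s₃  = v₃
right-end e₀₁ = v₁
right-end e₀₂ = v₂
right-end e₀₃ = v₃
right-end e₂₃ = v₃

-- Higher rank is better; singletons and non-incident edges get rank 0.
rank : Fin 4 → Fin 8 → ℕ
rank v₀ e₀₁ = 3
rank v₀ e₀₂ = 2
rank v₀ e₀₃ = 1
rank v₁ e₀₂ = 3
rank v₁ e₀₃ = 2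
rank v₁ e₀₁ = 1
rank v₂ e₂₃ = 3
rank v₂ e₀₂ = 2
rank v₂ e₀₃ = 1
rank v₃ e₀₃ = 2
rank v₃ e₂₃ = 1
rank _  _   = 0

prefers : Fin 4 → Fin 8 → Fin 8 → Bool
prefers i e e' = rank i e' <ᵇ rank i e

_∈?_ : ∀ (i : Fin 4) (e : Fin 8) → Dec (left-end e Fin.≤ i × i Fin.≤ right-end e)
i ∈? e = (left-end e ≤? i) ×-dec (i ≤? right-end e)

counterexample : IntervalHPS
counterexample = record
  { n = 4 ; m = 8 ; left = left-end ; right = right-end
  ; left≤right = toWitness {a? = all? λ e → left-end e ≤? right-end e} _
  ; edges-distinct = toWitness {a? = all? λ e → all? λ e' →
      (left-end e ≟ left-end e') →-dec ((right-end e ≟ right-end e') →-dec (e ≟ e'))} _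
  ; singletons = singleton
  ; pref = prefers
  ; ≻-irrefl = λ i e _ e≻e → ℕP.<-irrefl refl (ℕP.<ᵇ⇒< (rank i e) (rank i e) e≻e)
  ; ≻-trans = λ i e₁ e₂ e₃ _ _ _ e₁≻e₂ e₂≻e₃ → ℕP.<⇒<ᵇ (ℕP.<-trans
      (ℕP.<ᵇ⇒< (rank i e₃) (rank i e₂) e₂≻e₃) (ℕP.<ᵇ⇒< (rank i e₂) (rank i e₁) e₁≻e₂))
  ; ≻-total = toWitness {a? = all? λ i → all? λ e → all? λ e' →
      (i ∈? e) →-dec ((i ∈? e') →-dec (¬? (e ≟ e') →-dec
        (T? (prefers i e e') ⊎-dec T? (prefers i e' e))))} _
  ; singleton-least = toWitness {a? = all? λ i → all? λ e → all? λ s →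
      (i ∈? e) →-dec ((left-end s ≟ i) →-dec ((right-end s ≟ i) →-dec
        (¬? (e ≟ s) →-dec T? (prefers i e s))))} _
  }
  where
  singleton : ∀ i → ∃ λ e → left-end e ≡ i × right-end e ≡ i
  singleton v₀ = s₀ , refl , refl
  singleton v₁ = s₁ , refl , refl
  singleton v₂ = s₂ , refl , refl
  singleton v₃ = s₃ , refl , refl

supported : ℚ → ℚ → ℚ → Fin 8 → ℚ
supported p q r e₀₁ = p
supported p q r e₀₃ = q
supported p q r e₂₃ = r
supported p q r _   = 0ℚ

x½ : Fin 8 → ℚ
x½ = supported ½ ½ ½

x½∈Q : InQ counterexample x½
x½∈Q = toWitness {a? = all? λ i → sumOver (δ counterexample i) x½ ℚ.≤? 1ℚ} _
     , toWitness {a? = all? λ e → 1ℚ ℚ.≤? sumOver (upset counterexample e) x½} _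
     , toWitness {a? = all? λ e → (0ℚ ℚ.≤? x½ e) ×-dec (x½ e ℚ.≤? 1ℚ)} _

-- Each `with` normalises the goal, unfolding the sum so that the solver can read it.

sumOver-δ₀-supported : ∀ p q r → sumOver (δ counterexample v₀) (supported p q r) ≡ p + q
sumOver-δ₀-supported p q r with p | q
... | p | q = RingSolver.solve (p List.∷ q List.∷ List.[]) ℚ-ring

sumOver-δ₃-supported : ∀ p q r → sumOver (δ counterexample v₃) (supported p q r) ≡ q + r
sumOver-δ₃-supported p q r with q | r
... | q | r = RingSolver.solve (q List.∷ r List.∷ List.[]) ℚ-ring

sumOver-upset₀₂-supported : ∀ p q r → sumOver (upset counterexample e₀₂) (supported p q r) ≡ r + p
sumOver-upset₀₂-supported p q r with p | r
... | p | r = RingSolver.solve (p List.∷ r List.∷ List.[]) ℚ-ring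

supported-restriction : ∀ (w : Fin 8 → ℚ) → (∀ e → x½ e ≡ 0ℚ → w e ≡ 0ℚ) →
                        ∀ e → w e ≡ supported (w e₀₁) (w e₀₃) (w e₂₃) e
supported-restriction w vanishes s₀  = vanishes s₀ refl
supported-restriction w vanishes s₁  = vanishes s₁ refl
supported-restriction w vanishes s₂  = vanishes s₂ refl
supported-restriction w vanishes s₃  = vanishes s₃ refl
supported-restriction w vanishes e₀₁ = refl
supported-restriction w vanishes e₀₂ = vanishes e₀₂ refl
supported-restriction w vanishes e₀₃ = refl
supported-restriction w vanishes e₂₃ = refl

supported-halves : ∀ {p q r} → p ≡ ½ → q ≡ ½ → r ≡ ½ → ∀ e → supported p q r e ≡ x½ e
supported-halves refl refl refl e = refl

x½-determined : ∀ (w : Fin 8 → ℚ) → (∀ e → x½ e ≡ 0ℚ → w e ≡ 0ℚ) →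
                sumOver (δ counterexample v₀) w ≡ 1ℚ → sumOver (δ counterexample v₃) w ≡ 1ℚ →
                sumOver (upset counterexample e₀₂) w ≡ 1ℚ → ∀ e → w e ≡ x½ e
x½-determined w vanishes δ₀-tight δ₃-tight upset₀₂-tight e =
  trans (restricted e) (supported-halves
    (pairwise-sums-one⇒half a c d a+c≡1 c+d≡1 d+a≡1)
    (pairwise-sums-one⇒half c d a c+d≡1 d+a≡1 a+c≡1)
    (pairwise-sums-one⇒half d a c d+a≡1 a+c≡1 c+d≡1)
    e)
  where
  a c d : ℚ
  a = w e₀₁
  c = w e₀₃
  d = w e₂₃
  restricted : ∀ e → w e ≡ supported a c d e
  restricted = supported-restriction w vanishes
  on-support : ∀ F → sumOver F (supported a c d) ≡ sumOver F w
  on-support F = sym (sumOver-cong F {w} restricted)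
  a+c≡1 : a + c ≡ 1ℚ
  a+c≡1 = trans (sym (sumOver-δ₀-supported a c d)) (trans (on-support (δ counterexample v₀)) δ₀-tight)
  c+d≡1 : c + d ≡ 1ℚ
  c+d≡1 = trans (sym (sumOver-δ₃-supported a c d)) (trans (on-support (δ counterexample v₃)) δ₃-tight)
  d+a≡1 : d + a ≡ 1ℚ
  d+a≡1 = trans (sym (sumOver-upset₀₂-supported a c d))
                (trans (on-support (upset counterexample e₀₂)) upset₀₂-tight)

combination-equals-x½ : ∀ {y z : Fin 8 → ℚ} {s u} → 0ℚ ℚ.< s → 0ℚ ℚ.< u → s + u ≡ 1ℚ →
                        InQ counterexample y → InQ counterexample z →
                        (∀ e → x½ e ≡ s * y e + u * z e) → ∀ e → y e ≡ x½ e
combination-equals-x½ {y} s>0 u>0 s+u≡1 y∈Q z∈Q x½≡ =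
  x½-determined y zero-inherited
    (degree-tight-inherited v₀ refl) (degree-tight-inherited v₃ refl) (upset-tight-inherited e₀₂ refl)
  where open FaceOfQ counterexample s>0 u>0 s+u≡1 y∈Q z∈Q x½≡

x½-extreme : IsExtremeQ counterexample x½
x½-extreme = x½∈Q , λ y z t y∈Q z∈Q t>0 t<1 x½≡ e →
  trans (combination-equals-x½ t>0 (1-t>0 t<1) (t+[1-t]≡1 t) y∈Q z∈Q x½≡ e)
        (sym (combination-equals-x½ (1-t>0 t<1) t>0 (trans (ℚP.+-comm (1ℚ - t) t) (t+[1-t]≡1 t)) z∈Q y∈Q
                (λ e → trans (x½≡ e) (ℚP.+-comm (t * y e) ((1ℚ - t) * z e))) e))
  where
  t+[1-t]≡1 : ∀ t → t + (1ℚ - t) ≡ 1ℚ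
  t+[1-t]≡1 = RingSolver.solve-∀ ℚ-ring
  1-t>0 : ∀ {t} → t ℚ.< 1ℚ → 0ℚ ℚ.< 1ℚ - t
  1-t>0 {t} t<1 = subst (ℚ._< 1ℚ - t) (ℚP.+-inverseʳ t) (ℚP.+-monoˡ-< (ℚ.- t) t<1)

½-not-integer : ¬ ∃ λ (k : ℤ) → ½ ≡ k ℚ./ 1
½-not-integer (k , ½≡k/1) =
  denominator-of-½ (subst (λ q → ℚ.↧ q ℤ.* ℤ.+ 1 ≡ ℤ.+ 1) (sym ½≡k/1) denominator-of-k/1)
  where
  denominator-of-k/1 : ℚ.↧ (k ℚ./ 1) ℤ.* ℤ.+ 1 ≡ ℤ.+ 1
  denominator-of-k/1 = subst (λ g → ℚ.↧ (k ℚ./ 1) ℤ.* ℤ.+ g ≡ ℤ.+ 1) (gcd-zeroʳ ℤ.∣ k ∣) (ℚP.↧-/ k 1)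
  denominator-of-½ : ℚ.↧ ½ ℤ.* ℤ.+ 1 ≢ ℤ.+ 1
  denominator-of-½ ()

weakly-better-than-e₀₂ : ∀ i e → _∈ₕ_ counterexample i e₀₂ →
                         T (weakly-better counterexample i e₀₂ e) → e ≡ e₀₁ ⊎ e ≡ e₀₂ ⊎ e ≡ e₂₃
weakly-better-than-e₀₂ = toWitness {a? = all? λ i → all? λ e →
  (i ∈? e₀₂) →-dec (T? (weakly-better counterexample i e₀₂ e) →-dec
    ((e ≟ e₀₁) ⊎-dec ((e ≟ e₀₂) ⊎-dec (e ≟ e₂₃))))} _

e₀₃-never-selected : ∀ x → IsStableMatching counterexample x → x e₀₃ ≡ false
e₀₃-never-selected x (matching , stable) =
  ¬-not λ xc → blocking counterexample {x} (unselected xc) (stable e₀₂)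
  where
  displaced : ∀ {i e} → x e₀₃ ≡ true → _∈ₕ_ counterexample i e₀₃ → _∈ₕ_ counterexample i e →
              e ≢ e₀₃ → x e ≡ false
  displaced xc i∈c i∈e e≢c =
    ¬-not λ xe → e≢c (matching-one-edge-per-vertex counterexample {x} matching i∈e i∈c xe xc)
  unselected : x e₀₃ ≡ true → ∀ i e → _∈ₕ_ counterexample i e₀₂ →
               T (weakly-better counterexample i e₀₂ e) → x e ≡ false
  unselected xc i e i∈b better with weakly-better-than-e₀₂ i e i∈b better
  ... | inj₁ refl        = displaced {v₀} {e₀₁} xc (from-yes (v₀ ∈? e₀₃)) (from-yes (v₀ ∈? e₀₁)) λ ()
  ... | inj₂ (inj₁ refl) = displaced {v₀} {e₀₂} xc (from-yes (v₀ ∈? e₀₃)) (from-yes (v₀ ∈? e₀₂)) λ ()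
  ... | inj₂ (inj₂ refl) = displaced {v₃} {e₂₃} xc (from-yes (v₃ ∈? e₀₃)) (from-yes (v₃ ∈? e₂₃)) λ ()

theorem4p1 : Σ IntervalHPS λ I → ¬ QIntegral I × ¬ P≡Q I
theorem4p1 = counterexample , not-integral , P≢Q
  where
  not-integral : ¬ QIntegral counterexample
  not-integral integral = ½-not-integer (integral x½ x½-extreme e₀₁)
  P≢Q : ¬ P≡Q counterexample
  P≢Q P⇔Q = ½≢0 (never-selected⇒zero-in-P counterexample e₀₃-never-selected
                   (Equivalence.from (P⇔Q x½) x½∈Q))
    where
    ½≢0 : ½ ≢ 0ℚ
    ½≢0 ()
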